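{- Let $G$ be a finite simple graph and $e\in E(G)$. Then $$\gamma_{gr}(G)-1\le \gamma_{gr}(G-e)\le \gamma_{gr}(G)+1.$$ Moreover, there exist graphs $G$ such that each of the three values $\gamma_{gr}(G)-1$, $\gamma_{gr}(G)$, $\gamma_{gr}(G)+1$ is attained as $\gamma_{gr}(G-e)$ for some edge $e\in E(G)$ (different edges realizing different values).
   Context: For a vertex $v$ of a graph $G$, $N[v]$ denotes its closed neighborhood. A sequence $S=(v_1,\ldots,v_k)$ of distinct vertices of $G$ is a legal sequence if $N[v_i]\setminus\bigcup_{j=1}^{i-1}N[v_j]\neq\emptyset$ for every $i$. It is a dominating sequence if moreover $\{v_1,\ldots,v_k\}$ is a dominating set of $G$. The Grundy domination number $\gamma_{gr}(G)$ is the maximum length of a legal dominating sequence of $G$. $G-e$ denotes the graph obtained from $G$ by deleting the edge $e$. -}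

module Defs where

open import Data.Nat using (ℕ; zero; suc; _≤_; _+_)
open import Data.Fin using (Fin)
open import Data.Fin.Properties using () renaming (_≟_ to _≟ᶠ_)
open import Data.Bool using (Bool; true; false; _∧_; _∨_; not)
open import Data.Bool.Properties using (∧-comm; ∨-comm)
open import Data.List using (List; []; _∷_; length)
open import Data.List.Relation.Unary.All using (All)
open import Data.List.Relation.Unary.Any using (Any)
open import Data.List.Relation.Unary.Unique.Propositional using (Unique)
open import Data.Product using (Σ; _×_; _,_; ∃)
open import Data.Sum using (_⊎_)
open import Data.Unit using (⊤)
open import Relation.Nullary using (¬_; does)
open import Relation.Binary.PropositionalEquality using (_≡_; refl; cong₂; trans)

record Graph (n : ℕ) : Set where
  field
    adj   : Fin n → Fin n → Bool
    adj-sym : ∀ u v → adj u v ≡ adj v u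
    irrefl : ∀ v → adj v v ≡ false
open Graph public

-- An edge of G: an (ordered representative of an) unordered pair {u,v} with u ~ v.
record Edge {n : ℕ} (G : Graph n) : Set where
  constructor edge
  field
    u v : Fin n
    uv  : adj G u v ≡ true
open Edge public

_==_ : ∀ {n} → Fin n → Fin n → Bool
x == y = does (x ≟ᶠ y)

private
  isE : ∀ {n} → Fin n → Fin n → Fin n → Fin n → Bool
  isE a b x y = (x == a ∧ y == b) ∨ (x == b ∧ y == a)

  isE-sym : ∀ {n} (a b x y : Fin n) → isE a b x y ≡ isE a b y x
  isE-sym a b x y =
    trans (cong₂ _∨_ (∧-comm (x == a) (y == b)) (∧-comm (x == b) (y == a)))
          (∨-comm (y == b ∧ x == a) (y == a ∧ x == b))

_-ₑ_ : ∀ {n} (G : Graph n) → Edge G → Graph n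
adj (G -ₑ e) x y = adj G x y ∧ not (isE (u e) (v e) x y)
adj-sym (G -ₑ e) x y = cong₂ (λ p q → p ∧ not q) (adj-sym G x y) (isE-sym (u e) (v e) x y)
irrefl (G -ₑ e) x rewrite irrefl G x = refl

_∈N[_] : ∀ {n} {G : Graph n} → Fin n → Fin n → Set
_∈N[_] {G = G} w v = w ≡ v ⊎ adj G v w ≡ true

LegalFrom : ∀ {n} (G : Graph n) → List (Fin n) → List (Fin n) → Set
LegalFrom G prev [] = ⊤
LegalFrom G prev (x ∷ xs) =
  (∃ λ w → _∈N[_] {G = G} w x × All (λ y → ¬ (_∈N[_] {G = G} w y)) prev)
  × LegalFrom G (x ∷ prev) xs

Legal : ∀ {n} (G : Graph n) → List (Fin n) → Set
Legal G S = Unique S × LegalFrom G [] S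

Dominating : ∀ {n} (G : Graph n) → List (Fin n) → Set
Dominating G S = ∀ w → Any (λ y → _∈N[_] {G = G} w y) S

LegalDominating : ∀ {n} (G : Graph n) → List (Fin n) → Set
LegalDominating G S = Legal G S × Dominating G S

IsGrundyDom : ∀ {n} (G : Graph n) → ℕ → Set
IsGrundyDom G k =
  (∃ λ S → LegalDominating G S × length S ≡ k)
  × (∀ S → LegalDominating G S → length S ≤ k)

-- Deleting the edge e = uv changes the closed neighbourhoods only of u and v,
-- and only in that u and v stop footprinting each other. Hence in a legal
-- sequence of G at most one vertex (the first one that is an endpoint of e and
-- footprints only its partner) ceases to be legal in G − e; dropping it, every
-- later footprint avoids u and v, where the two graphs look the same. The same
-- holds for restoring the edge, and since every legal sequence extends to a
-- legal dominating one, γ_gr(G) ≤ γ_gr(G − e) + 1 and conversely.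
module Submission where

open import Defs
open import Data.Nat using (ℕ; zero; suc; _≤_; _+_; z≤n; s≤s)
open import Data.Nat.Properties using (≤-refl; ≤-trans; +-comm; m≤m+n; module ≤-Reasoning)
open import Data.Fin using (Fin; zero; suc; #_; toℕ)
open import Data.Fin.Properties using () renaming (_≟_ to _≟ᶠ_; any? to anyᶠ?; all? to allᶠ?)
open import Data.Bool using (Bool; true; false; _∨_)
open import Data.Bool.Properties using (∨-comm; ∧-identityʳ) renaming (_≟_ to _≟ᵇ_)
open import Data.List using (List; []; _∷_; length; _∷ʳ_; _ʳ++_; reverse; allFin)
open import Data.List.Properties using (length-++)
open import Data.List.Relation.Unary.All as All using (All; []; _∷_; all?)
open import Data.List.Relation.Unary.All.Properties using (¬Any⇒All¬)
open import Data.List.Relation.Unary.Any using (Any; here; there; any?)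
open import Data.List.Relation.Unary.Any.Properties using (++⁺ˡ; ++⁺ʳ; reverse⁻)
open import Data.List.Relation.Unary.AllPairs using ([]; _∷_)
open import Data.List.Relation.Unary.Unique.Propositional using (Unique)
open import Data.List.Membership.Propositional using (_∈_; _∉_)
open import Data.List.Membership.Propositional.Properties using (∈-allFin)
open import Data.Product as Prod using (Σ; _×_; _,_; ∃)
open import Data.Sum as Sum using (_⊎_; inj₁; inj₂)
open import Data.Empty using (⊥-elim)
open import Data.Unit using (tt)
open import Function using (_∘_)
open import Relation.Nullary using (¬_; Dec; yes; no)
open import Relation.Nullary.Decidable using (_⊎-dec_; _×-dec_; _→-dec_; ¬?; toWitness; True)
open import Relation.Binary.PropositionalEquality using (_≡_; refl; sym; trans)

infix 4 _∈N[_]in_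

_∈N[_]in_ : ∀ {n} → Fin n → Fin n → Graph n → Set
w ∈N[ y ]in G = _∈N[_] {G = G} w y

module _ {n : ℕ} (G : Graph n) where

  Undominated : List (Fin n) → Fin n → Set
  Undominated p w = All (λ y → ¬ w ∈N[ y ]in G) p

  LegalAfter : List (Fin n) → Fin n → Set
  LegalAfter p x = ∃ λ w → w ∈N[ x ]in G × Undominated p w

  Dominates : List (Fin n) → Fin n → Set
  Dominates S w = Any (λ y → w ∈N[ y ]in G) S

  ∈N? : ∀ w y → Dec (w ∈N[ y ]in G)
  ∈N? w y = (w ≟ᶠ y) ⊎-dec (adj G y w ≟ᵇ true)

  undominated? : ∀ p w → Dec (Undominated p w)
  undominated? p w = all? (λ y → ¬? (∈N? w y)) p

  legalAfter? : ∀ p x → Dec (LegalAfter p x)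
  legalAfter? p x = anyᶠ? (λ w → ∈N? w x ×-dec undominated? p w)

  legalFrom? : ∀ p xs → Dec (LegalFrom G p xs)
  legalFrom? p [] = yes tt
  legalFrom? p (x ∷ xs) = legalAfter? p x ×-dec legalFrom? (x ∷ p) xs

  dominating? : ∀ S → Dec (Dominating G S)
  dominating? S = allᶠ? (λ w → any? (λ y → ∈N? w y) S)

  legalFrom-∉ : ∀ {p y} xs → LegalFrom G p xs → y ∈ p → y ∉ xs
  legalFrom-∉ (x ∷ xs) ((w , w∈N[x] , undom) , _) y∈p (here refl) = All.lookup undom y∈p w∈N[x]
  legalFrom-∉ (x ∷ xs) (_ , legal) y∈p (there y∈xs) = legalFrom-∉ xs legal (there y∈p) y∈xs

  legalFrom⇒unique : ∀ {p} xs → LegalFrom G p xs → Unique xs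
  legalFrom⇒unique [] _ = []
  legalFrom⇒unique (x ∷ xs) (_ , legal) =
    ¬Any⇒All¬ xs (legalFrom-∉ xs legal (here refl)) ∷ legalFrom⇒unique xs legal

  legalFrom-∷ʳ : ∀ {p x} xs → LegalFrom G p xs → LegalAfter (xs ʳ++ p) x → LegalFrom G p (xs ∷ʳ x)
  legalFrom-∷ʳ [] _ legal-x = legal-x , tt
  legalFrom-∷ʳ (y ∷ xs) (legal-y , legal) legal-x = legal-y , legalFrom-∷ʳ xs legal legal-x

  absorb-head : ∀ {y ws} {P Q : Fin n → Set} → (∀ w → w ∈ y ∷ ws ⊎ P w) → Q y →
                (∀ {w} → P w → Q w) → ∀ w → w ∈ ws ⊎ Q w
  absorb-head covered Qy P⇒Q w with covered w
  ... | inj₁ (here refl) = inj₂ Qy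
  ... | inj₁ (there w∈ws) = inj₁ w∈ws
  ... | inj₂ Pw = inj₂ (P⇒Q Pw)

  -- Greedy: append every vertex of ws that is not yet dominated; it footprints itself.
  legalFrom-extend : ∀ ws S → LegalFrom G [] S → (∀ w → w ∈ ws ⊎ Dominates S w) →
                     ∃ λ T → LegalDominating G T × length S ≤ length T
  legalFrom-extend [] S legal covered =
    S , ((legalFrom⇒unique S legal , legal) , dominated) , ≤-refl
    where
      dominated : Dominating G S
      dominated w with covered w
      ... | inj₂ d = d
  legalFrom-extend (y ∷ ws) S legal covered with any? (∈N? y) S
  ... | yes y-dominated = legalFrom-extend ws S legal (absorb-head covered y-dominated (λ d → d))
  ... | no y-undominated
    with legalFrom-extend ws (S ∷ʳ y)
           (legalFrom-∷ʳ S legal (y , inj₁ refl , ¬Any⇒All¬ (reverse S) (y-undominated ∘ reverse⁻)))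
           (absorb-head covered (++⁺ʳ S (here (inj₁ refl))) ++⁺ˡ)
  ... | T , T-legalDominating , S∷ʳy≤T =
    T , T-legalDominating , ≤-trans S≤S∷ʳy S∷ʳy≤T
    where
      S≤S∷ʳy : length S ≤ length (S ∷ʳ y)
      S≤S∷ʳy rewrite length-++ S {y ∷ []} = m≤m+n (length S) 1

  IsGrundyDom-bound : ∀ {k} S → IsGrundyDom G k → LegalFrom G [] S → length S ≤ k
  IsGrundyDom-bound S (_ , maximal) legal
    with legalFrom-extend (allFin n) S legal (λ w → inj₁ (∈-allFin w))
  ... | T , T-legalDominating , S≤T = ≤-trans S≤T (maximal T T-legalDominating)

IsGrundyDom-≤-suc : ∀ {n} {G H : Graph n} {k k′} →
  (∀ S → LegalFrom G [] S → ∃ λ T → LegalFrom H [] T × length S ≤ suc (length T)) →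
  IsGrundyDom G k → IsGrundyDom H k′ → k ≤ k′ + 1
IsGrundyDom-≤-suc {H = H} {k′ = k′} shorten ((S , ((_ , legal) , _) , refl) , _) γH
  with shorten S legal
... | T , T-legal , S≤1+T = begin
  length S        ≤⟨ S≤1+T ⟩
  suc (length T)  ≤⟨ s≤s (IsGrundyDom-bound H T γH T-legal) ⟩
  suc k′          ≡⟨ +-comm 1 k′ ⟩
  k′ + 1          ∎
  where open ≤-Reasoning

∈N-transport : ∀ {n} {G H : Graph n} {w y} → (∀ z → adj G z w ≡ adj H z w) →
               w ∈N[ y ]in G → w ∈N[ y ]in H
∈N-transport _ (inj₁ w≡y) = inj₁ w≡y
∈N-transport agree (inj₂ y~w) = inj₂ (trans (sym (agree _)) y~w)

legalFrom-transfer : ∀ {n} {G H : Graph n} (Safe : Fin n → Set) →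
  (∀ z w → Safe w → adj G z w ≡ adj H z w) →
  ∀ {p q} → (∀ w → Undominated G p w → Undominated H q w × Safe w) →
  ∀ xs → LegalFrom G p xs → LegalFrom H q xs
legalFrom-transfer Safe agree inv [] _ = tt
legalFrom-transfer {G = G} {H} Safe agree {p} {q} inv (x ∷ xs) ((w , w∈N[x] , undom) , legal) =
  (w , ∈N-transport {G = G} {H} (λ z → agree z w safe-w) w∈N[x] , undom-H) ,
  legalFrom-transfer Safe agree inv′ xs legal
  where
    undom-H = Prod.proj₁ (inv w undom)
    safe-w = Prod.proj₂ (inv w undom)

    inv′ : ∀ w′ → Undominated G (x ∷ p) w′ → Undominated H (x ∷ q) w′ × Safe w′
    inv′ w′ (w′∉N[x] ∷ undom′) with inv w′ undom′
    ... | undom-H′ , safe-w′ =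
      (w′∉N[x] ∘ ∈N-transport {G = H} {G} (λ z → sym (agree z w′ safe-w′))) ∷ undom-H′ , safe-w′

module _ {n : ℕ} (G : Graph n) (e : Edge G) where

  IsEndpoint : Fin n → Set
  IsEndpoint w = w ≡ u e ⊎ w ≡ v e

  Endpoints : Fin n → Fin n → Set
  Endpoints z w = (z ≡ u e × w ≡ v e) ⊎ (z ≡ v e × w ≡ u e)

  endpoints? : ∀ z w → Dec (Endpoints z w)
  endpoints? z w = ((z ≟ᶠ u e) ×-dec (w ≟ᶠ v e)) ⊎-dec ((z ≟ᶠ v e) ×-dec (w ≟ᶠ u e))

  endpoints-sym : ∀ {z w} → Endpoints z w → Endpoints w z
  endpoints-sym = Sum.swap ∘ Sum.map Prod.swap Prod.swap

  endpoints⇒isEndpointˡ : ∀ {z w} → Endpoints z w → IsEndpoint z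
  endpoints⇒isEndpointˡ = Sum.map Prod.proj₁ Prod.proj₁

  endpoints⇒isEndpointʳ : ∀ {z w} → Endpoints z w → IsEndpoint w
  endpoints⇒isEndpointʳ = endpoints⇒isEndpointˡ ∘ endpoints-sym

  endpoints-cover : ∀ {z w y} → Endpoints z w → IsEndpoint y → y ≡ z ⊎ y ≡ w
  endpoints-cover (inj₁ (refl , refl)) (inj₁ refl) = inj₁ refl
  endpoints-cover (inj₁ (refl , refl)) (inj₂ refl) = inj₂ refl
  endpoints-cover (inj₂ (refl , refl)) (inj₁ refl) = inj₂ refl
  endpoints-cover (inj₂ (refl , refl)) (inj₂ refl) = inj₁ refl

  isEndpoint-∈N : ∀ {x y} → IsEndpoint x → IsEndpoint y → y ∈N[ x ]in G
  isEndpoint-∈N (inj₁ refl) (inj₁ refl) = inj₁ refl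
  isEndpoint-∈N (inj₁ refl) (inj₂ refl) = inj₂ (uv e)
  isEndpoint-∈N (inj₂ refl) (inj₁ refl) = inj₂ (trans (adj-sym G (v e) (u e)) (uv e))
  isEndpoint-∈N (inj₂ refl) (inj₂ refl) = inj₁ refl

  adj-ₑ-off : ∀ z w → ¬ Endpoints z w → adj (G -ₑ e) z w ≡ adj G z w
  adj-ₑ-off z w off with z ≟ᶠ u e | w ≟ᶠ v e | z ≟ᶠ v e | w ≟ᶠ u e
  ... | yes p | yes q | _     | _     = ⊥-elim (off (inj₁ (p , q)))
  ... | _     | _     | yes p | yes q = ⊥-elim (off (inj₂ (p , q)))
  ... | no _  | _     | no _  | _     = ∧-identityʳ (adj G z w)
  ... | no _  | _     | yes _ | no _  = ∧-identityʳ (adj G z w)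
  ... | yes _ | no _  | no _  | _     = ∧-identityʳ (adj G z w)
  ... | yes _ | no _  | yes _ | no _  = ∧-identityʳ (adj G z w)

  adj-ₑ-away : ∀ z w → ¬ IsEndpoint w → adj (G -ₑ e) z w ≡ adj G z w
  adj-ₑ-away z w w-away = adj-ₑ-off z w (w-away ∘ endpoints⇒isEndpointʳ)

  ∈N-ₑ⇒∈N : ∀ {w y} → w ∈N[ y ]in (G -ₑ e) → w ∈N[ y ]in G
  ∈N-ₑ⇒∈N (inj₁ w≡y) = inj₁ w≡y
  ∈N-ₑ⇒∈N {w} {y} (inj₂ y~w) with adj G y w
  ... | true = inj₂ refl

  ∈N-removed : ∀ {w y} → w ∈N[ y ]in G → ¬ w ∈N[ y ]in (G -ₑ e) → Endpoints y w
  ∈N-removed (inj₁ w≡y) w∉N[y] = ⊥-elim (w∉N[y] (inj₁ w≡y))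
  ∈N-removed {w} {y} (inj₂ y~w) w∉N[y] with endpoints? y w
  ... | yes ends = ends
  ... | no ¬ends = ⊥-elim (w∉N[y] (inj₂ (trans (adj-ₑ-off y w ¬ends) y~w)))

  undominated-deleteEdge : ∀ {p w} → Undominated G p w → Undominated (G -ₑ e) p w
  undominated-deleteEdge = All.map (λ w∉N[y] → w∉N[y] ∘ ∈N-ₑ⇒∈N)

  -- Restoring e can only make w dominated by its partner, which dominates itself.
  undominated-restoreEdge : ∀ {p w} → Undominated (G -ₑ e) p w →
    (∀ {w″} → Endpoints w w″ → Undominated (G -ₑ e) p w″) → Undominated G p w
  undominated-restoreEdge {[]} _ _ = []
  undominated-restoreEdge {y ∷ p} {w} (w∉N[y] ∷ undom) partner =
    w∉Nᴳ[y] ∷ undominated-restoreEdge undom (All.tail ∘ partner)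
    where
      w∉Nᴳ[y] : ¬ w ∈N[ y ]in G
      w∉Nᴳ[y] w∈N[y] = All.head (partner (endpoints-sym (∈N-removed w∈N[y] w∉N[y]))) (inj₁ refl)

  legalFrom-deleteEdge : ∀ p xs → LegalFrom G p xs →
    ∃ λ T → LegalFrom (G -ₑ e) p T × length xs ≤ suc (length T)
  legalFrom-deleteEdge p [] _ = [] , tt , z≤n
  legalFrom-deleteEdge p (x ∷ xs) (legal-x , legal) with legalAfter? (G -ₑ e) p x
  ... | yes legal-x′ with legalFrom-deleteEdge (x ∷ p) xs legal
  ...   | T , T-legal , xs≤1+T = x ∷ T , (legal-x′ , T-legal) , s≤s xs≤1+T
  legalFrom-deleteEdge p (x ∷ xs) ((w , w∈N[x] , undom) , legal) | no illegal-x =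
    xs , legalFrom-transfer (¬_ ∘ IsEndpoint) (λ z w′ away → sym (adj-ₑ-away z w′ away)) inv xs legal , ≤-refl
    where
      x-endpoint : IsEndpoint x
      x-endpoint = endpoints⇒isEndpointˡ
        (∈N-removed w∈N[x] (λ w∈N′[x] → illegal-x (w , w∈N′[x] , undominated-deleteEdge undom)))

      inv : ∀ w′ → Undominated G (x ∷ p) w′ → Undominated (G -ₑ e) p w′ × ¬ IsEndpoint w′
      inv w′ (w′∉N[x] ∷ undom′) =
        undominated-deleteEdge undom′ , w′∉N[x] ∘ isEndpoint-∈N x-endpoint

  legalFrom-restoreEdge : ∀ p xs → LegalFrom (G -ₑ e) p xs →
    ∃ λ T → LegalFrom G p T × length xs ≤ suc (length T)
  legalFrom-restoreEdge p [] _ = [] , tt , z≤n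
  legalFrom-restoreEdge p (x ∷ xs) (legal-x , legal) with legalAfter? G p x
  ... | yes legal-x′ with legalFrom-restoreEdge (x ∷ p) xs legal
  ...   | T , T-legal , xs≤1+T = x ∷ T , (legal-x′ , T-legal) , s≤s xs≤1+T
  legalFrom-restoreEdge p (x ∷ xs) ((w , w∈N[x] , undom) , legal) | no illegal-x =
    xs , legalFrom-transfer (¬_ ∘ IsEndpoint) (λ z w′ away → adj-ₑ-away z w′ away) inv xs legal , ≤-refl
    where
      inv : ∀ w′ → Undominated (G -ₑ e) (x ∷ p) w′ → Undominated G p w′ × ¬ IsEndpoint w′
      inv w′ (w′∉N[x] ∷ undom′) =
        undominated-restoreEdge undom′ (⊥-elim ∘ w′-away ∘ endpoints⇒isEndpointˡ) , w′-away
        where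
          partner : IsEndpoint w′ → ∀ {w″} → Endpoints w w″ → Undominated (G -ₑ e) p w″
          partner w′-endpoint ends with endpoints-cover ends w′-endpoint
          ... | inj₁ refl = ⊥-elim (w′∉N[x] w∈N[x])
          ... | inj₂ refl = undom′

          -- An endpoint w′ outside N[x] would leave w legal for x in G as well.
          w′-away : ¬ IsEndpoint w′
          w′-away w′-endpoint =
            illegal-x (w , ∈N-ₑ⇒∈N w∈N[x] , undominated-restoreEdge undom (partner w′-endpoint))

module _ {n : ℕ} (G : Graph n) where

  LegalLengthsAtMost : List (Fin n) → ℕ → Set
  LegalLengthsAtMost p zero = ∀ x → ¬ LegalAfter G p x
  LegalLengthsAtMost p (suc b) = ∀ x → LegalAfter G p x → LegalLengthsAtMost (x ∷ p) b

  legalLengthsAtMost? : ∀ p b → Dec (LegalLengthsAtMost p b)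
  legalLengthsAtMost? p zero = allᶠ? (λ x → ¬? (legalAfter? G p x))
  legalLengthsAtMost? p (suc b) = allᶠ? (λ x → legalAfter? G p x →-dec legalLengthsAtMost? (x ∷ p) b)

  legalLengthsAtMost-sound : ∀ {p} b xs → LegalLengthsAtMost p b → LegalFrom G p xs → length xs ≤ b
  legalLengthsAtMost-sound b [] _ _ = z≤n
  legalLengthsAtMost-sound zero (x ∷ xs) bounded (legal-x , _) = ⊥-elim (bounded x legal-x)
  legalLengthsAtMost-sound (suc b) (x ∷ xs) bounded (legal-x , legal) =
    s≤s (legalLengthsAtMost-sound b xs (bounded x legal-x) legal)

  IsGrundyDom-bySearch : ∀ S → True (legalFrom? G [] S ×-dec dominating? G S) →
    True (legalLengthsAtMost? [] (length S)) → IsGrundyDom G (length S)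
  IsGrundyDom-bySearch S found exhausted =
    (S , ((legalFrom⇒unique G S legal , legal) , dominating) , refl) ,
    λ T ((_ , T-legal) , _) → legalLengthsAtMost-sound (length S) T (toWitness exhausted) T-legal
    where
      legal = Prod.proj₁ (toWitness found)
      dominating = Prod.proj₂ (toWitness found)

-- The path 0−1−2−3 plus the disjoint edge 4−5, with γ_gr = 3 + 1. Deleting
-- 1−2, 0−1 or 4−5 leaves 3K₂, K₁+P₃+K₂ or P₄+2K₁, with γ_gr 3, 4 and 5.
P₄+K₂-edge : ℕ → ℕ → Bool
P₄+K₂-edge 0 1 = true
P₄+K₂-edge 1 2 = true
P₄+K₂-edge 2 3 = true
P₄+K₂-edge 4 5 = true
P₄+K₂-edge _ _ = false

P₄+K₂ : Graph 6
adj P₄+K₂ x y = P₄+K₂-edge (toℕ x) (toℕ y) ∨ P₄+K₂-edge (toℕ y) (toℕ x)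
adj-sym P₄+K₂ x y = ∨-comm (P₄+K₂-edge (toℕ x) (toℕ y)) (P₄+K₂-edge (toℕ y) (toℕ x))
irrefl P₄+K₂ zero = refl
irrefl P₄+K₂ (suc zero) = refl
irrefl P₄+K₂ (suc (suc zero)) = refl
irrefl P₄+K₂ (suc (suc (suc zero))) = refl
irrefl P₄+K₂ (suc (suc (suc (suc zero)))) = refl
irrefl P₄+K₂ (suc (suc (suc (suc (suc zero))))) = refl

theorem2p1 : ((n : ℕ) (G : Graph n) (e : Edge G) (k k′ : ℕ) →
    IsGrundyDom G k → IsGrundyDom (G -ₑ e) k′ →
    (k ≤ k′ + 1) × (k′ ≤ k + 1))
    × (∃ λ n → Σ (Graph n) λ G → ∃ λ k →
    IsGrundyDom G (suc k)
    × (∃ λ (e₁ : Edge G) → IsGrundyDom (G -ₑ e₁) k)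
    × (∃ λ (e₂ : Edge G) → IsGrundyDom (G -ₑ e₂) (suc k))
    × (∃ λ (e₃ : Edge G) → IsGrundyDom (G -ₑ e₃) (suc (suc k))))
theorem2p1 =
  (λ n G e k k′ γG γG-e →
    IsGrundyDom-≤-suc (legalFrom-deleteEdge G e []) γG γG-e ,
    IsGrundyDom-≤-suc (legalFrom-restoreEdge G e []) γG-e γG) ,
  (6 , P₄+K₂ , 3 ,
    IsGrundyDom-bySearch P₄+K₂ (# 3 ∷ # 2 ∷ # 1 ∷ # 4 ∷ []) _ _ ,
    (edge (# 1) (# 2) refl , IsGrundyDom-bySearch _ (# 0 ∷ # 2 ∷ # 4 ∷ []) _ _) ,
    (edge (# 0) (# 1) refl , IsGrundyDom-bySearch _ (# 0 ∷ # 1 ∷ # 3 ∷ # 4 ∷ []) _ _) ,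
    (edge (# 4) (# 5) refl , IsGrundyDom-bySearch _ (# 3 ∷ # 2 ∷ # 1 ∷ # 4 ∷ # 5 ∷ []) _ _))
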